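{- Let $k\ge 2$ and $s_1,\dots,s_k\in\mathbb{N}$ with all $s_i\ge 3$. Then $$m(s_1,\dots,s_k)\le \max\left\{\min_{i\in\{1,\dots,k\}}\prod_{j=0}^{s_i-3}\left\lceil\frac{(n_i-2)-j}{s_i-2}\right\rceil\right\},$$ where the maximum is taken over all $n_1,\dots,n_k\in\mathbb{N}$ satisfying: (1) $n_i\ge s_i$ for all $i$; (2) $n_1+\dots+n_k\le R(s_1,\dots,s_k)+2(k-1)$; (3) for all distinct $i,j$, writing $a\in\{i,j\}$ for an index with $n_a=\max\{n_i,n_j\}$ and $b$ for the other index, $|n_i-n_j|<R\bigl(s_a-1,\,R(s_\ell:\ell\neq a)\bigr)-(s_b-2)$.
   Context: $K_n$ is the complete graph on $n$ vertices. For $s_1,\dots,s_k\in\mathbb{N}$, the Ramsey number $R(s_1,\dots,s_k)$ is the smallest $n$ such that every coloring of the edges of $K_n$ with colors $\{1,\dots,k\}$ contains, for some $i$, a subgraph isomorphic to $K_{s_i}$ all of whose edges have color $i$ (a monochromatic $K_{s_i}$ in color $i$); for a single argument $R(s)=s$, and $R(s_\ell:\ell\ne a)$ is the Ramsey number of the list with $s_a$ removed. The critical multiplicity $m(s_1,\dots,s_k)$ is the largest $M$ such that every $k$-coloring of the edges of $K_{R(s_1,\dots,s_k)}$ contains at least $M$ subgraphs each of which, for some $i$, is isomorphic to $K_{s_i}$ and monochromatic in color $i$. -}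

module Defs where

open import Data.Nat using (ℕ; zero; suc; _+_; _*_; _∸_; _≤_; _<_; pred)
open import Data.Nat.DivMod using (_/_)
open import Data.Fin using (Fin; zero; suc; punchIn)
open import Data.Fin.Subset using (Subset; _∈_; ∣_∣)
open import Data.Product using (Σ; _×_; _,_; proj₁)
open import Function using (_∘_)
open import Function.Definitions using (Injective)
open import Relation.Binary.PropositionalEquality using (_≡_; _≢_)

-- A k-colouring of the edges of K_n: a symmetric map on pairs of vertices
-- (values on the diagonal x = x are irrelevant).
record Colouring (n k : ℕ) : Set where
  field
    col : Fin n → Fin n → Fin k
    sym : ∀ x y → col x y ≡ col y x
open Colouring public

Mono : ∀ {n k} → (Fin k → ℕ) → Colouring n k → Fin k → Subset n → Set
Mono s c i S = (∣ S ∣ ≡ s i) ×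
  (∀ x y → x ∈ S → y ∈ S → x ≢ y → col c x y ≡ i)

MonoCopy : ∀ {n k} → (Fin k → ℕ) → Colouring n k → Set
MonoCopy {n} {k} s c = Σ (Fin k × Subset n) (λ p → Mono s c (Data.Product.proj₁ p) (Data.Product.proj₂ p))

HasMono : ∀ {n k} → (Fin k → ℕ) → Colouring n k → Set
HasMono s c = MonoCopy s c

AtLeast : ∀ {n k} → (Fin k → ℕ) → ℕ → Colouring n k → Set
AtLeast s M c = Σ (Fin M → MonoCopy s c) (λ f → Injective _≡_ _≡_ (proj₁ ∘ f))

IsRamsey : (k : ℕ) → (Fin k → ℕ) → ℕ → Set
IsRamsey k s R =
  ((c : Colouring R k) → HasMono s c) ×
  (∀ n → ((c : Colouring n k) → HasMono s c) → R ≤ n)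

IsCritMult : (k : ℕ) → (Fin k → ℕ) → ℕ → ℕ → Set
IsCritMult k s R M =
  ((c : Colouring R k) → AtLeast s M c) ×
  (∀ M′ → ((c : Colouring R k) → AtLeast s M′ c) → M′ ≤ M)

remove : ∀ {k} → (Fin k → ℕ) → Fin k → Fin (pred k) → ℕ
remove {suc k} s a = s ∘ punchIn a

pair : ℕ → ℕ → Fin 2 → ℕ
pair x y zero = x
pair x y (suc _) = y

sumFin : ∀ {k} → (Fin k → ℕ) → ℕ
sumFin {zero} f = 0
sumFin {suc k} f = f zero + sumFin (f ∘ suc)

prodTo : ℕ → (ℕ → ℕ) → ℕ
prodTo zero f = 1
prodTo (suc m) f = prodTo m f * f m

-- ⌈ a / b ⌉ (b = 0 never used; set to 0)
ceilDiv : ℕ → ℕ → ℕ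
ceilDiv a zero = 0
ceilDiv a (suc b) = (a + b) / suc b

P : ℕ → ℕ → ℕ
P s n = prodTo (s ∸ 2) (λ j → ceilDiv ((n ∸ 2) ∸ j) (s ∸ 2))

{-# OPTIONS --safe #-}

-- Fix a colouring c of K_{R-1} without monochromatic copies and a vertex v of it.  Let V_i be the
-- set of colour-i neighbours of v, d_i = |V_i| and n_i = d_i + 2; the V_i are disjoint subsets of
-- the other R - 2 vertices, which gives the bound on Σ n_i.  Adding a twin v′ of v, with vv′
-- coloured i, gives a colouring of K_R whose monochromatic copies all have colour i and contain v
-- and v′; deleting v and v′ leaves distinct (s_i - 2)-cliques of colour i in V_i, while V_i has no
-- colour-i (s_i - 1)-clique.  By Zykov symmetrisation a K_{r+1}-free graph on d vertices has at
-- most as many r-cliques as the Turán graph T(d, r), which is the product in the statement; and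
-- since some copy exists, s_i ≤ n_i.  Finally d_a < R(s_a - 1, R(s_l : l ≠ a)): otherwise V_a
-- holds a colour-a K_{s_a - 1}, which v completes to a monochromatic K_{s_a}, or R(s_l : l ≠ a)
-- vertices spanning no colour-a edge, hence a monochromatic K_{s_l} for some l ≠ a.

module Submission where

open import Defs hiding (sym)
open import Data.Nat hiding (∣_-_∣)
open import Data.Nat.Properties
open import Data.Nat.DivMod
open import Data.Nat.Divisibility using (divides-refl; ∣-refl)
open import Data.Nat.Tactic.RingSolver using (solve-∀)
open import Data.Empty using (⊥-elim)
open import Data.Fin using (Fin; zero; suc; punchIn; punchOut; inject≤; combine)
import Data.Fin.Properties as Fin
open import Data.Fin.Subset
open import Data.Fin.Subset.Properties
open import Data.Product using (Σ; ∃; _×_; _,_; proj₁; proj₂)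
open import Data.Sum using (_⊎_; inj₁; inj₂)
open import Data.Vec using ([]; _∷_; here; there; head; tail)
import Data.Vec.Functional as Vector
open import Function using (_∘_; case_of_)
open import Function.Definitions using (Injective)
open import Level using (Level; 0ℓ)
open import Relation.Binary using (Rel; Reflexive)
open import Relation.Binary.PropositionalEquality
open import Relation.Nullary using (Dec; yes; no; does; ¬_)
open import Relation.Nullary.Decidable using (_×-dec_; _→-dec_; ¬?; map′; decidable-stable)
open import Relation.Unary using (Pred; Decidable)

-- The number of r-cliques of the Turán graph T(d, r), whose parts have sizes ⌈(d - j)/r⌉ for
-- j < r.  P s n unfolds to turán (n ∸ 2) (s ∸ 2).
turán : ℕ → ℕ → ℕ
turán d r = prodTo r (λ j → ceilDiv (d ∸ j) r)

prodTo-const : ∀ m {f : ℕ → ℕ} {c} → (∀ {j} → j < m → f j ≡ c) → prodTo m f ≡ c ^ m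
prodTo-const zero     f≡c = refl
prodTo-const (suc m) {c = c} f≡c =
  trans (cong₂ _*_ (prodTo-const m (f≡c ∘ m<n⇒m<1+n)) (f≡c ≤-refl)) (*-comm (c ^ m) c)

prodTo-+ : ∀ a b (f : ℕ → ℕ) → prodTo (a + b) f ≡ prodTo a f * prodTo b (λ j → f (a + j))
prodTo-+ a zero    f = trans (cong (λ n → prodTo n f) (+-identityʳ a)) (sym (*-identityʳ _))
prodTo-+ a (suc b) f = begin
  prodTo (a + suc b) f                                   ≡⟨ cong (λ n → prodTo n f) (+-suc a b) ⟩
  prodTo (a + b) f * f (a + b)                           ≡⟨ cong (_* f (a + b)) (prodTo-+ a b f) ⟩
  prodTo a f * prodTo b (λ j → f (a + j)) * f (a + b)    ≡⟨ *-assoc (prodTo a f) _ _ ⟩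
  prodTo a f * prodTo (suc b) (λ j → f (a + j))          ∎
  where open ≡-Reasoning

prodTo-mono-≤ : ∀ m {f g : ℕ → ℕ} → (∀ j → f j ≤ g j) → prodTo m f ≤ prodTo m g
prodTo-mono-≤ zero    f≤g = ≤-refl
prodTo-mono-≤ (suc m) f≤g = *-mono-≤ (prodTo-mono-≤ m f≤g) (f≤g m)

turán-monoˡ-≤ : ∀ {d d′} r → d ≤ d′ → turán d r ≤ turán d′ r
turán-monoˡ-≤ zero    d≤d′ = ≤-refl
turán-monoˡ-≤ (suc r) d≤d′ =
  prodTo-mono-≤ (suc r) (λ j → /-monoˡ-≤ (suc r) (+-monoˡ-≤ r (∸-monoˡ-≤ j d≤d′)))

ceilDiv-≡ : ∀ {a q x r} → x ≤ r → a + r ≡ x + q * suc r → ceilDiv a (suc r) ≡ q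
ceilDiv-≡ {a} {q} {x} {r} x≤r eq = begin
  (a + r) / suc r               ≡⟨ /-congˡ eq ⟩
  (x + q * suc r) / suc r       ≡⟨ +-distrib-/-∣ʳ x (divides-refl q) ⟩
  x / suc r + q * suc r / suc r ≡⟨ cong₂ _+_ (m<n⇒m/n≡0 (s≤s x≤r)) (m*n/n≡m q (suc r)) ⟩
  q                             ∎
  where open ≡-Reasoning

-- The first t parts of T(q (r+1) + t, r+1) have size q + 1, the remaining ones size q.
ceilDiv-large-part : ∀ q j x r → x ≤ r →
  ceilDiv (q * suc r + suc (j + x) ∸ j) (suc r) ≡ suc q
ceilDiv-large-part q j x r x≤r = ceilDiv-≡ x≤r (begin
  q * suc r + suc (j + x) ∸ j + r   ≡⟨ cong (λ a → a ∸ j + r) (shift q j x r) ⟩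
  j + (q * suc r + suc x) ∸ j + r   ≡⟨ cong (_+ r) (m+n∸m≡n j _) ⟩
  q * suc r + suc x + r             ≡⟨ regroup q x r ⟩
  x + suc q * suc r                 ∎)
  where
  open ≡-Reasoning
  shift : ∀ q j x r → q * suc r + suc (j + x) ≡ j + (q * suc r + suc x)
  shift = solve-∀
  regroup : ∀ q x r → q * suc r + suc x + r ≡ x + suc q * suc r
  regroup = solve-∀

ceilDiv-small-part : ∀ q t i r → i ≤ r → ceilDiv (q * suc r + t ∸ (t + i)) (suc r) ≡ q
ceilDiv-small-part q t i r i≤r rewrite +-comm (q * suc r) t | [m+n]∸[m+o]≡n∸o t (q * suc r) i = small q
  where
  open ≡-Reasoning
  small : ∀ q → ceilDiv (q * suc r ∸ i) (suc r) ≡ q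
  small zero    = ceilDiv-≡ ≤-refl (trans (cong (_+ r) (0∸n≡0 i)) (sym (+-identityʳ r)))
  small (suc q) = ceilDiv-≡ (m∸n≤m r i) (begin
    Q ∸ i + r               ≡⟨ cong (Q ∸ i +_) (m+[n∸m]≡n i≤r) ⟨
    Q ∸ i + (i + (r ∸ i))   ≡⟨ +-assoc (Q ∸ i) i (r ∸ i) ⟨
    Q ∸ i + i + (r ∸ i)     ≡⟨ cong (_+ (r ∸ i)) (m∸n+n≡m i≤Q) ⟩
    Q + (r ∸ i)             ≡⟨ +-comm Q (r ∸ i) ⟩
    r ∸ i + Q               ∎)
    where
    Q = suc q * suc r
    i≤Q : i ≤ Q
    i≤Q = ≤-trans i≤r (≤-trans (n≤1+n r) (m≤m+n (suc r) (q * suc r)))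

turán-closed : ∀ q t u {r} → t + u ≡ suc r → turán (q * suc r + t) (suc r) ≡ suc q ^ t * q ^ u
turán-closed q t u {r} t+u≡ = begin
  prodTo (suc r) part                          ≡⟨ cong (λ n → prodTo n part) t+u≡ ⟨
  prodTo (t + u) part                          ≡⟨ prodTo-+ t u part ⟩
  prodTo t part * prodTo u (λ i → part (t + i)) ≡⟨ cong₂ _*_ (prodTo-const t large) (prodTo-const u small) ⟩
  suc q ^ t * q ^ u                            ∎
  where
  open ≡-Reasoning
  part : ℕ → ℕ
  part j = ceilDiv (q * suc r + t ∸ j) (suc r)
  large : ∀ {j} → j < t → part j ≡ suc q
  large {j} j<t = subst (λ t → ceilDiv (q * suc r + t ∸ j) (suc r) ≡ suc q) t≡
                    (ceilDiv-large-part q j x r x≤r)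
    where
    x = t ∸ suc j
    t≡ : suc (j + x) ≡ t
    t≡ = m+[n∸m]≡n j<t
    x≤r : x ≤ r
    x≤r = ≤-trans (m≤n+m x j) (≤-pred (subst (_≤ suc r) (sym t≡) (subst (t ≤_) t+u≡ (m≤m+n t u))))
  small : ∀ {i} → i < u → part (t + i) ≡ q
  small {i} i<u = ceilDiv-small-part q t i r (≤-pred (subst (suc i ≤_) t+u≡ (≤-trans i<u (m≤n+m u t))))

module _ (r : ℕ) where

  private
    divMod-parts : ∀ e → Σ ℕ λ t → Σ ℕ λ u → e ≡ e / suc r * suc r + t × t + suc u ≡ suc r
    divMod-parts e = t , suc r ∸ suc t , trans (m≡m%n+[m/n]*n e (suc r)) (+-comm t _) ,
                     trans (+-suc t _) (m+[n∸m]≡n (m%n<n e (suc r)))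
      where t = e % suc r

    swap-* : ∀ a b c → a * (b * c) ≡ b * (a * c)
    swap-* = solve-∀

  turán-step : ∀ e → Σ ℕ λ Y → turán e (suc r) ≡ e / suc r * Y × turán (suc e) (suc r) ≡ suc (e / suc r) * Y
  turán-step e with divMod-parts e
  ... | t , u , e≡ , t+u≡ = suc q ^ t * q ^ u , at-e , at-suc-e
    where
    open ≡-Reasoning
    q = e / suc r
    at-e : turán e (suc r) ≡ q * (suc q ^ t * q ^ u)
    at-e = begin
      turán e (suc r)                 ≡⟨ cong (λ d → turán d (suc r)) e≡ ⟩
      turán (q * suc r + t) (suc r)   ≡⟨ turán-closed q t (suc u) t+u≡ ⟩
      suc q ^ t * (q * q ^ u)         ≡⟨ swap-* (suc q ^ t) q (q ^ u) ⟩
      q * (suc q ^ t * q ^ u)         ∎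
    at-suc-e : turán (suc e) (suc r) ≡ suc q * (suc q ^ t * q ^ u)
    at-suc-e = begin
      turán (suc e) (suc r)               ≡⟨ cong (λ d → turán (suc d) (suc r)) e≡ ⟩
      turán (suc (q * suc r + t)) (suc r) ≡⟨ cong (λ d → turán d (suc r)) (+-suc (q * suc r) t) ⟨
      turán (q * suc r + suc t) (suc r)   ≡⟨ turán-closed q (suc t) u (trans (sym (+-suc t u)) t+u≡) ⟩
      suc q * suc q ^ t * q ^ u           ≡⟨ *-assoc (suc q) (suc q ^ t) (q ^ u) ⟩
      suc q * (suc q ^ t * q ^ u)         ∎

  private
    q+e-divMod : ∀ q e t → e ≡ q * suc r + t → q + e ≡ q * suc (suc r) + t
    q+e-divMod q e t refl = lemma q r t
      where
      lemma : ∀ q r t → q + (q * suc r + t) ≡ q * suc (suc r) + t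
      lemma = solve-∀

  turán-peak : ∀ e → e / suc r * turán e (suc r) ≡ turán (e / suc r + e) (suc (suc r))
  turán-peak e with divMod-parts e
  ... | t , u , e≡ , t+u≡ = begin
    q * turán e (suc r)                 ≡⟨ cong (λ d → q * turán d (suc r)) e≡ ⟩
    q * turán (q * suc r + t) (suc r)   ≡⟨ cong (q *_) (turán-closed q t (suc u) t+u≡) ⟩
    q * (suc q ^ t * q ^ suc u)         ≡⟨ swap-* q (suc q ^ t) (q ^ suc u) ⟩
    suc q ^ t * q ^ suc (suc u)
      ≡⟨ turán-closed q t (suc (suc u)) (trans (+-suc t (suc u)) (cong suc t+u≡)) ⟨
    turán (q * suc (suc r) + t) (suc (suc r)) ≡⟨ cong (λ d → turán d (suc (suc r))) (q+e-divMod q e t e≡) ⟨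
    turán (q + e) (suc (suc r))         ∎
    where
    open ≡-Reasoning
    q = e / suc r

  turán-peak-suc : ∀ e → suc (e / suc r) * turán e (suc r) ≡ turán (suc (e / suc r) + e) (suc (suc r))
  turán-peak-suc e with divMod-parts e
  ... | t , u , e≡ , t+u≡ = begin
    suc q * turán e (suc r)                 ≡⟨ cong (λ d → suc q * turán d (suc r)) e≡ ⟩
    suc q * turán (q * suc r + t) (suc r)   ≡⟨ cong (suc q *_) (turán-closed q t (suc u) t+u≡) ⟩
    suc q * (suc q ^ t * q ^ suc u)         ≡⟨ *-assoc (suc q) (suc q ^ t) (q ^ suc u) ⟨
    suc q ^ suc t * q ^ suc u               ≡⟨ turán-closed q (suc t) (suc u) (cong suc t+u≡) ⟨
    turán (q * suc (suc r) + suc t) (suc (suc r)) ≡⟨ cong (λ d → turán d (suc (suc r))) (+-suc _ t) ⟩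
    turán (suc (q * suc (suc r) + t)) (suc (suc r))
      ≡⟨ cong (λ d → turán (suc d) (suc (suc r))) (q+e-divMod q e t e≡) ⟨
    turán (suc q + e) (suc (suc r))         ∎
    where
    open ≡-Reasoning
    q = e / suc r

  private
    suc-/-≤ : ∀ e → suc e / suc r ≤ suc (e / suc r)
    suc-/-≤ e = begin
      suc e / suc r                ≤⟨ /-monoˡ-≤ (suc r) (subst (suc e ≤_) (sym (+-suc e r)) (s≤s (m≤m+n e r))) ⟩
      (e + suc r) / suc r          ≡⟨ +-distrib-/-∣ʳ e ∣-refl ⟩
      e / suc r + suc r / suc r    ≡⟨ cong (e / suc r +_) (n/n≡1 (suc r)) ⟩
      e / suc r + 1                ≡⟨ +-comm (e / suc r) 1 ⟩
      suc (e / suc r)              ∎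
      where open ≤-Reasoning

    exchange : ∀ {x y} → x ≤ y → suc y * x ≤ y * suc x
    exchange {x} {y} x≤y = subst (suc y * x ≤_) (sym (*-suc y x)) (+-monoˡ-≤ (y * x) x≤y)

  -- b * turán e (suc r) is the product of the part sizes of a partition of b + e into r + 2 parts.
  -- Moving a vertex between the part of size b and an extreme part of the balanced partition of e,
  -- from the larger to the smaller, does not decrease it; the partition becomes balanced once b is
  -- e / suc r or suc (e / suc r).
  *-turán-shiftˡ : ∀ {b} e → e / suc r ≤ b → suc b * turán e (suc r) ≤ b * turán (suc e) (suc r)
  *-turán-shiftˡ {b} e q≤b with turán-step e
  ... | Y , at-e , at-suc-e = begin
    suc b * turán e (suc r)     ≡⟨ cong (suc b *_) at-e ⟩
    suc b * (q * Y)             ≡⟨ *-assoc (suc b) q Y ⟨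
    suc b * q * Y               ≤⟨ *-monoˡ-≤ Y (exchange q≤b) ⟩
    b * suc q * Y               ≡⟨ *-assoc b (suc q) Y ⟩
    b * (suc q * Y)             ≡⟨ cong (b *_) at-suc-e ⟨
    b * turán (suc e) (suc r)   ∎
    where
    open ≤-Reasoning
    q = e / suc r

  *-turán-shiftʳ : ∀ {b} e → b ≤ e / suc r → b * turán (suc e) (suc r) ≤ suc b * turán e (suc r)
  *-turán-shiftʳ {b} e b≤q with turán-step e
  ... | Y , at-e , at-suc-e = begin
    b * turán (suc e) (suc r)   ≡⟨ cong (b *_) at-suc-e ⟩
    b * (suc q * Y)             ≡⟨ *-assoc b (suc q) Y ⟨
    b * suc q * Y               ≡⟨ cong (_* Y) (*-comm b (suc q)) ⟩
    suc q * b * Y               ≤⟨ *-monoˡ-≤ Y (exchange b≤q) ⟩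
    q * suc b * Y               ≡⟨ cong (_* Y) (*-comm q (suc b)) ⟩
    suc b * q * Y               ≡⟨ *-assoc (suc b) q Y ⟩
    suc b * (q * Y)             ≡⟨ cong (suc b *_) at-e ⟨
    suc b * turán e (suc r)     ∎
    where
    open ≤-Reasoning
    q = e / suc r

  private
    *-turán-≤-above : ∀ b e → e / suc r ≤ b → b * turán e (suc r) ≤ turán (b + e) (suc (suc r))
    *-turán-≤-above b e q≤b with m≤n⇒m<n∨m≡n q≤b
    ... | inj₂ refl = ≤-reflexive (turán-peak e)
    *-turán-≤-above (suc b) e _ | inj₁ (s≤s q≤b) with m≤n⇒m<n∨m≡n q≤b
    ... | inj₂ refl = ≤-reflexive (turán-peak-suc e)
    ... | inj₁ q<b = begin
      suc b * turán e (suc r)           ≤⟨ *-turán-shiftˡ e (<⇒≤ q<b) ⟩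
      b * turán (suc e) (suc r)         ≤⟨ *-turán-≤-above b (suc e) (≤-trans (suc-/-≤ e) q<b) ⟩
      turán (b + suc e) (suc (suc r))   ≡⟨ cong (λ d → turán d (suc (suc r))) (+-suc b e) ⟩
      turán (suc b + e) (suc (suc r))   ∎
      where open ≤-Reasoning

    *-turán-≤-below : ∀ b e → b ≤ e / suc r → b * turán e (suc r) ≤ turán (b + e) (suc (suc r))
    *-turán-≤-below b e b≤q with m≤n⇒m<n∨m≡n b≤q
    ... | inj₂ refl = ≤-reflexive (turán-peak e)
    *-turán-≤-below b (suc e) b≤q | inj₁ b<q = begin
      b * turán (suc e) (suc r)         ≤⟨ *-turán-shiftʳ e b≤q′ ⟩
      suc b * turán e (suc r)           ≤⟨ continue (≤-total (suc b) (e / suc r)) ⟩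
      turán (suc b + e) (suc (suc r))   ≡⟨ cong (λ d → turán d (suc (suc r))) (+-suc b e) ⟨
      turán (b + suc e) (suc (suc r))   ∎
      where
      open ≤-Reasoning
      b≤q′ : b ≤ e / suc r
      b≤q′ = ≤-pred (≤-trans b<q (suc-/-≤ e))
      continue : suc b ≤ e / suc r ⊎ e / suc r ≤ suc b →
                 suc b * turán e (suc r) ≤ turán (suc b + e) (suc (suc r))
      continue (inj₁ b<q′) = *-turán-≤-below (suc b) e b<q′
      continue (inj₂ q′≤b) = *-turán-≤-above (suc b) e q′≤b

  *-turán-suc-≤ : ∀ b e → b * turán e (suc r) ≤ turán (b + e) (suc (suc r))
  *-turán-suc-≤ b e with ≤-total b (e / suc r)
  ... | inj₁ b≤q = *-turán-≤-below b e b≤q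
  ... | inj₂ q≤b = *-turán-≤-above b e q≤b

*-turán-≤ : ∀ r b e → b * turán e r ≤ turán (b + e) (suc r)
*-turán-≤ zero b e = begin
  b * 1                    ≡⟨ *-identityʳ b ⟩
  b                        ≤⟨ m≤m+n b e ⟩
  b + e                    ≡⟨ n/1≡n (b + e) ⟨
  (b + e) / 1              ≡⟨ cong (_/ 1) (+-identityʳ (b + e)) ⟨
  (b + e + 0) / 1          ≡⟨ *-identityˡ _ ⟨
  turán (b + e) 1          ∎
  where open ≤-Reasoning
*-turán-≤ (suc r) = *-turán-suc-≤ r

module FiniteSubsets where

  private
    variable
      ℓ : Level
      m n : ℕ
      x y : Fin n
      p q r : Subset n

  enum : (p : Subset n) → Fin ∣ p ∣ → Fin n
  enum (inside  ∷ p) zero    = zero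
  enum (inside  ∷ p) (suc i) = suc (enum p i)
  enum (outside ∷ p) i       = suc (enum p i)

  enum-∈ : (p : Subset n) (i : Fin ∣ p ∣) → enum p i ∈ p
  enum-∈ (inside  ∷ p) zero    = here
  enum-∈ (inside  ∷ p) (suc i) = there (enum-∈ p i)
  enum-∈ (outside ∷ p) i       = there (enum-∈ p i)

  enum-injective : (p : Subset n) → Injective _≡_ _≡_ (enum p)
  enum-injective (inside  ∷ p) {zero}  {zero}  _  = refl
  enum-injective (inside  ∷ p) {suc i} {suc j} eq = cong suc (enum-injective p (Fin.suc-injective eq))
  enum-injective (outside ∷ p) eq = enum-injective p (Fin.suc-injective eq)

  rank : (p : Subset n) → x ∈ p → Fin ∣ p ∣
  rank (inside  ∷ p) here        = zero
  rank (inside  ∷ p) (there x∈p) = suc (rank p x∈p)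
  rank (outside ∷ p) (there x∈p) = rank p x∈p

  rank-injective : (p : Subset n) (x∈p : x ∈ p) (y∈p : y ∈ p) → rank p x∈p ≡ rank p y∈p → x ≡ y
  rank-injective (inside  ∷ p) here        here        _  = refl
  rank-injective (inside  ∷ p) (there x∈p) (there y∈p) eq =
    cong suc (rank-injective p x∈p y∈p (Fin.suc-injective eq))
  rank-injective (outside ∷ p) (there x∈p) (there y∈p) eq = cong suc (rank-injective p x∈p y∈p eq)

  ∣p∣≡0⇒Empty : ∣ p ∣ ≡ 0 → Empty p
  ∣p∣≡0⇒Empty {p = p} ∣p∣≡0 (x , x∈p) = Fin.¬Fin0 (subst Fin ∣p∣≡0 (rank p x∈p))

  injection⇒∣p∣≤ : (h : ∀ {x} → x ∈ p → Fin m) →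
    (∀ {x y} (x∈p : x ∈ p) (y∈p : y ∈ p) → h x∈p ≡ h y∈p → x ≡ y) → ∣ p ∣ ≤ m
  injection⇒∣p∣≤ {p = p} h h-inj =
    Fin.injective⇒≤ {f = h ∘ enum-∈ p} (enum-injective p ∘ h-inj (enum-∈ p _) (enum-∈ p _))

  injection⇒≤∣p∣ : (e : Fin m → Fin n) → Injective _≡_ _≡_ e → (∀ i → e i ∈ p) → m ≤ ∣ p ∣
  injection⇒≤∣p∣ {p = p} e e-inj e∈p =
    Fin.injective⇒≤ {f = rank p ∘ e∈p} (e-inj ∘ rank-injective p (e∈p _) (e∈p _))

  fromDec : {P : Pred (Fin n) ℓ} → Decidable P → Subset n
  fromDec {n = zero}  P? = []
  fromDec {n = suc n} P? = does (P? zero) ∷ fromDec (P? ∘ suc)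

  ∈-fromDec⁺ : {P : Pred (Fin n) ℓ} (P? : Decidable P) → P x → x ∈ fromDec P?
  ∈-fromDec⁺ {x = zero}  P? Px with P? zero
  ... | yes _  = here
  ... | no ¬Px = ⊥-elim (¬Px Px)
  ∈-fromDec⁺ {x = suc x} P? Px = there (∈-fromDec⁺ (P? ∘ suc) Px)

  ∈-fromDec⁻ : {P : Pred (Fin n) ℓ} (P? : Decidable P) → x ∈ fromDec P? → P x
  ∈-fromDec⁻ {x = zero}  P? x∈ with P? zero
  ... | yes Px = Px
  ∈-fromDec⁻ {x = zero}  P? () | no _
  ∈-fromDec⁻ {x = suc x} P? (there x∈) = ∈-fromDec⁻ (P? ∘ suc) x∈

  x∈p─q⇒x∉q : ∀ (p q : Subset n) → x ∈ p ─ q → x ∉ q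
  x∈p─q⇒x∉q (inside ∷ p) (outside ∷ q) here        ()
  x∈p─q⇒x∉q (_      ∷ p) (_       ∷ q) (there x∈) (there x∈q) = x∈p─q⇒x∉q p q x∈ x∈q

  x∈p-y⇒x≢y : x ∈ p - y → x ≢ y
  x∈p-y⇒x≢y {x = x} {p = p} x∈ refl = x∈p─q⇒x∉q p ⁅ x ⁆ x∈ (x∈⁅x⁆ x)

  ∣p-x∣+1≡∣p∣ : x ∈ p → suc ∣ p - x ∣ ≡ ∣ p ∣
  ∣p-x∣+1≡∣p∣ {x = zero}  {p = inside ∷ p}  here        = cong (suc ∘ ∣_∣) (p─⊥≡p p)
  ∣p-x∣+1≡∣p∣ {x = suc x} {p = inside ∷ p}  (there x∈p) = cong suc (∣p-x∣+1≡∣p∣ x∈p)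
  ∣p-x∣+1≡∣p∣ {x = suc x} {p = outside ∷ p} (there x∈p) = ∣p-x∣+1≡∣p∣ x∈p

  p-x≡q-x⇒p≡q : x ∈ p → x ∈ q → p - x ≡ q - x → p ≡ q
  p-x≡q-x⇒p≡q {x = x} {p = p} {q = q} x∈p x∈q eq = ⊆-antisym (⊆-via x∈q eq) (⊆-via x∈p (sym eq))
    where
    ⊆-via : ∀ {p q} → x ∈ q → p - x ≡ q - x → p ⊆ q
    ⊆-via {p} {q} x∈q eq {y} y∈p with y Fin.≟ x
    ... | yes refl = x∈q
    ... | no y≢x   = p─q⊆p q ⁅ x ⁆ (subst (y ∈_) eq (x∈p∧x≢y⇒x∈p-y y∈p y≢x))

  ∣⁅x⁆∪p∣≡1+∣p∣ : x ∉ p → ∣ ⁅ x ⁆ ∪ p ∣ ≡ suc ∣ p ∣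
  ∣⁅x⁆∪p∣≡1+∣p∣ {x = zero}  {p = inside ∷ p}  x∉p = ⊥-elim (x∉p here)
  ∣⁅x⁆∪p∣≡1+∣p∣ {x = zero}  {p = outside ∷ p} x∉p = cong (suc ∘ ∣_∣) (∪-identityˡ p)
  ∣⁅x⁆∪p∣≡1+∣p∣ {x = suc x} {p = inside ∷ p}  x∉p = cong suc (∣⁅x⁆∪p∣≡1+∣p∣ (x∉p ∘ there))
  ∣⁅x⁆∪p∣≡1+∣p∣ {x = suc x} {p = outside ∷ p} x∉p = ∣⁅x⁆∪p∣≡1+∣p∣ (x∉p ∘ there)

  x∈⁅y⁆∪p⁻ : x ∈ ⁅ y ⁆ ∪ p → x ≡ y ⊎ x ∈ p
  x∈⁅y⁆∪p⁻ {y = y} {p = p} x∈ with x∈p∪q⁻ ⁅ y ⁆ p x∈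
  ... | inj₁ x∈⁅y⁆ = inj₁ (x∈⁅y⁆⇒x≡y y x∈⁅y⁆)
  ... | inj₂ x∈p   = inj₂ x∈p

  Disjoint : Subset n → Subset n → Set
  Disjoint p q = ∀ {x} → x ∈ p → x ∉ q

  drop-∷-Disjoint : ∀ {a b} → Disjoint (a ∷ p) (b ∷ q) → Disjoint p q
  drop-∷-Disjoint pq x∈p x∈q = pq (there x∈p) (there x∈q)

  ∣p∣+∣q∣≤∣r∣ : ∀ {p q r : Subset n} → p ⊆ r → q ⊆ r → Disjoint p q → ∣ p ∣ + ∣ q ∣ ≤ ∣ r ∣
  ∣p∣+∣q∣≤∣r∣ {p = []}          {[]}          {[]}          _   _   _  = z≤n
  ∣p∣+∣q∣≤∣r∣ {p = inside  ∷ p} {inside  ∷ q} {_}           _   _   pq = ⊥-elim (pq here here)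
  ∣p∣+∣q∣≤∣r∣ {p = inside  ∷ p} {outside ∷ q} {outside ∷ r} p⊆r _   _  with () ← p⊆r here
  ∣p∣+∣q∣≤∣r∣ {p = outside ∷ p} {inside  ∷ q} {outside ∷ r} _   q⊆r _  with () ← q⊆r here
  ∣p∣+∣q∣≤∣r∣ {p = inside  ∷ p} {outside ∷ q} {inside  ∷ r} p⊆r q⊆r pq =
    s≤s (∣p∣+∣q∣≤∣r∣ (drop-∷-⊆ p⊆r) (drop-∷-⊆ q⊆r) (drop-∷-Disjoint pq))
  ∣p∣+∣q∣≤∣r∣ {p = outside ∷ p} {inside  ∷ q} {inside  ∷ r} p⊆r q⊆r pq =
    subst (_≤ suc ∣ r ∣) (sym (+-suc ∣ p ∣ ∣ q ∣))
      (s≤s (∣p∣+∣q∣≤∣r∣ (drop-∷-⊆ p⊆r) (drop-∷-⊆ q⊆r) (drop-∷-Disjoint pq)))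
  ∣p∣+∣q∣≤∣r∣ {p = outside ∷ p} {outside ∷ q} {inside  ∷ r} p⊆r q⊆r pq =
    m≤n⇒m≤1+n (∣p∣+∣q∣≤∣r∣ (drop-∷-⊆ p⊆r) (drop-∷-⊆ q⊆r) (drop-∷-Disjoint pq))
  ∣p∣+∣q∣≤∣r∣ {p = outside ∷ p} {outside ∷ q} {outside ∷ r} p⊆r q⊆r pq =
    ∣p∣+∣q∣≤∣r∣ (drop-∷-⊆ p⊆r) (drop-∷-⊆ q⊆r) (drop-∷-Disjoint pq)

  sumFin-∣∣≤ : ∀ {k} (V : Fin k → Subset n) → (∀ i → V i ⊆ r) →
    (∀ {i j x} → x ∈ V i → x ∈ V j → i ≡ j) → sumFin (∣_∣ ∘ V) ≤ ∣ r ∣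
  sumFin-∣∣≤ {k = zero}  V V⊆r disjoint = z≤n
  sumFin-∣∣≤ {r = r} {k = suc k} V V⊆r disjoint = begin
    ∣ V zero ∣ + sumFin (∣_∣ ∘ V ∘ suc)
      ≤⟨ +-monoʳ-≤ ∣ V zero ∣ (sumFin-∣∣≤ (V ∘ suc) V⊆rest (λ x∈ y∈ → Fin.suc-injective (disjoint x∈ y∈))) ⟩
    ∣ V zero ∣ + ∣ rest ∣
      ≤⟨ ∣p∣+∣q∣≤∣r∣ (V⊆r zero) (p─q⊆p r (V zero)) (λ x∈ x∈rest → x∈p─q⇒x∉q r (V zero) x∈rest x∈) ⟩
    ∣ r ∣
      ∎
    where
    open ≤-Reasoning
    rest = r ─ V zero
    V⊆rest : ∀ i → V (suc i) ⊆ rest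
    V⊆rest i x∈ = x∈p∧x∉q⇒x∈p─q (V⊆r (suc i) x∈) (λ x∈V₀ → case disjoint x∈ x∈V₀ of λ ())

  image : (Fin m → Fin n) → Subset m → Subset n
  image e p = fromDec (λ y → Fin.any? (λ x → x ∈? p ×-dec e x Fin.≟ y))

  ∈-image⁺ : (e : Fin m → Fin n) → x ∈ p → e x ∈ image e p
  ∈-image⁺ e x∈p = ∈-fromDec⁺ _ (_ , x∈p , refl)

  ∈-image⁻ : (e : Fin m → Fin n) → y ∈ image e p → ∃ λ x → x ∈ p × e x ≡ y
  ∈-image⁻ e = ∈-fromDec⁻ _

  ∣image∣≡∣p∣ : (e : Fin m → Fin n) → Injective _≡_ _≡_ e → ∣ image e p ∣ ≡ ∣ p ∣
  ∣image∣≡∣p∣ {p = p} e e-inj = ≤-antisym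
    (injection⇒∣p∣≤ (λ y∈ → rank p (preimage∈ y∈)) preimage-injective)
    (injection⇒≤∣p∣ (e ∘ enum p) (enum-injective p ∘ e-inj) (λ i → ∈-image⁺ e (enum-∈ p i)))
    where
    preimage∈ : (y∈ : y ∈ image e p) → proj₁ (∈-image⁻ e y∈) ∈ p
    preimage∈ y∈ = proj₁ (proj₂ (∈-image⁻ e y∈))
    preimage-injective : ∀ {y z} (y∈ : y ∈ image e p) (z∈ : z ∈ image e p) →
      rank p (preimage∈ y∈) ≡ rank p (preimage∈ z∈) → y ≡ z
    preimage-injective y∈ z∈ eq with ∈-image⁻ e y∈ | ∈-image⁻ e z∈ | rank-injective p _ _ eq
    ... | _ , _ , refl | _ , _ , refl | x≡x′ = cong e x≡x′

  bounded-fibres : (ℓ : Fin m → Fin n) {W : Subset n} {B : ℕ} → (∀ t → ℓ t ∈ W) →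
    (∀ {w} → w ∈ W → ∀ {m′} (g : Fin m′ → Fin m) → Injective _≡_ _≡_ g → (∀ j → ℓ (g j) ≡ w) → m′ ≤ B) →
    m ≤ ∣ W ∣ * B
  bounded-fibres {m = m} ℓ {W} {B} ℓ∈W fibre-≤ = Fin.injective⇒≤ {f = code} code-injective
    where
    fibre : Fin _ → Subset m
    fibre w = fromDec (λ t → ℓ t Fin.≟ w)
    ∣fibre∣≤B : ∀ {w} → w ∈ W → ∣ fibre w ∣ ≤ B
    ∣fibre∣≤B {w} w∈W =
      fibre-≤ w∈W (enum (fibre w)) (enum-injective (fibre w)) (λ j → ∈-fromDec⁻ _ (enum-∈ (fibre w) j))
    index : ∀ {w t} → w ∈ W → t ∈ fibre w → Fin B
    index {w} w∈W t∈ = inject≤ (rank (fibre w) t∈) (∣fibre∣≤B w∈W)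
    index-injective : ∀ {w w′ t t′} → w ≡ w′ → (w∈W : w ∈ W) (w′∈W : w′ ∈ W)
      (t∈ : t ∈ fibre w) (t′∈ : t′ ∈ fibre w′) → index w∈W t∈ ≡ index w′∈W t′∈ → t ≡ t′
    index-injective refl _ _ t∈ t′∈ eq = rank-injective (fibre _) t∈ t′∈ (Fin.inject≤-injective _ _ _ _ eq)
    t∈fibre : ∀ t → t ∈ fibre (ℓ t)
    t∈fibre t = ∈-fromDec⁺ (λ t′ → ℓ t′ Fin.≟ ℓ t) refl
    code : Fin m → Fin (∣ W ∣ * B)
    code t = combine (rank W (ℓ∈W t)) (index (ℓ∈W t) (t∈fibre t))
    code-injective : Injective _≡_ _≡_ code
    code-injective {t} {t′} eq with Fin.combine-injective _ _ _ _ eq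
    ... | same-w , same-index =
      index-injective (rank-injective W _ _ same-w) (ℓ∈W t) (ℓ∈W t′) (t∈fibre t) (t∈fibre t′) same-index

  argmax-∈ : (f : Fin n → ℕ) (p : Subset n) → Nonempty p → ∃ λ x → x ∈ p × (∀ {y} → y ∈ p → f y ≤ f x)
  argmax-∈ f (outside ∷ p) (suc x , there x∈p) with argmax-∈ (f ∘ suc) p (x , x∈p)
  ... | x′ , x′∈p , max = suc x′ , there x′∈p , λ { (there y∈p) → max y∈p }
  argmax-∈ f (inside ∷ p) _ with nonempty? p
  ... | no empty = zero , here , λ { here → ≤-refl ; (there y∈p) → ⊥-elim (empty (_ , y∈p)) }
  ... | yes ne with argmax-∈ (f ∘ suc) p ne
  ...   | x′ , x′∈p , max with f zero ≤? f (suc x′)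
  ...     | yes f₀≤ = suc x′ , there x′∈p , λ { here → f₀≤ ; (there y∈p) → max y∈p }
  ...     | no f₀≰  = zero , here , λ { here → ≤-refl ; (there y∈p) → ≤-trans (max y∈p) (<⇒≤ (≰⇒> f₀≰)) }

  ∣p∣≡1+k⇒Nonempty : ∀ {k} → ∣ p ∣ ≡ suc k → Nonempty p
  ∣p∣≡1+k⇒Nonempty {p = p} eq = enum p i , enum-∈ p i
    where i = subst Fin (sym eq) zero

open FiniteSubsets

module Graph {n : ℕ} (E : Fin n → Fin n → Set) (E? : ∀ x y → Dec (E x y))
             (E-sym : ∀ {x y} → E x y → E y x) where

  IsClique : ℕ → Subset n → Set
  IsClique r S = ∣ S ∣ ≡ r × (∀ x y → x ∈ S → y ∈ S → x ≢ y → E x y)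

  CliqueFree : ℕ → Subset n → Set
  CliqueFree r V = ∀ {S} → S ⊆ V → ¬ IsClique r S

  nbhd : Subset n → Fin n → Subset n
  nbhd V x = fromDec (λ y → y ∈? V ×-dec ¬? (x Fin.≟ y) ×-dec E? x y)

  ∈-nbhd⁺ : ∀ {V x y} → y ∈ V → x ≢ y → E x y → y ∈ nbhd V x
  ∈-nbhd⁺ y∈V x≢y xy = ∈-fromDec⁺ _ (y∈V , x≢y , xy)

  ∈-nbhd⁻ : ∀ {V x y} → y ∈ nbhd V x → y ∈ V × x ≢ y × E x y
  ∈-nbhd⁻ = ∈-fromDec⁻ _

  nbhd⊆ : ∀ {V x} → nbhd V x ⊆ V
  nbhd⊆ = proj₁ ∘ ∈-nbhd⁻

  clique-insert : ∀ {r V S x} → IsClique r S → S ⊆ nbhd V x → IsClique (suc r) (⁅ x ⁆ ∪ S)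
  clique-insert {S = S} {x} (∣S∣≡r , S-adj) S⊆nbhd = size , adj
    where
    x∉S : x ∉ S
    x∉S x∈S = proj₁ (proj₂ (∈-nbhd⁻ (S⊆nbhd x∈S))) refl
    size : ∣ ⁅ x ⁆ ∪ S ∣ ≡ suc _
    size = trans (∣⁅x⁆∪p∣≡1+∣p∣ x∉S) (cong suc ∣S∣≡r)
    adj : ∀ y z → y ∈ ⁅ x ⁆ ∪ S → z ∈ ⁅ x ⁆ ∪ S → y ≢ z → E y z
    adj y z y∈ z∈ y≢z with x∈⁅y⁆∪p⁻ y∈ | x∈⁅y⁆∪p⁻ z∈
    ... | inj₁ refl | inj₁ refl = ⊥-elim (y≢z refl)
    ... | inj₁ refl | inj₂ z∈S  = proj₂ (proj₂ (∈-nbhd⁻ (S⊆nbhd z∈S)))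
    ... | inj₂ y∈S  | inj₁ refl = E-sym (proj₂ (proj₂ (∈-nbhd⁻ (S⊆nbhd y∈S))))
    ... | inj₂ y∈S  | inj₂ z∈S  = S-adj y z y∈S z∈S y≢z

  ⁅x⁆∪nbhd⊆ : ∀ {V S x} → x ∈ V → S ⊆ nbhd V x → ⁅ x ⁆ ∪ S ⊆ V
  ⁅x⁆∪nbhd⊆ x∈V S⊆nbhd y∈ with x∈⁅y⁆∪p⁻ y∈
  ... | inj₁ refl = x∈V
  ... | inj₂ y∈S  = nbhd⊆ (S⊆nbhd y∈S)

  clique-remove : ∀ {r S x} → IsClique (suc r) S → x ∈ S → IsClique r (S - x)
  clique-remove {S = S} (∣S∣≡1+r , S-adj) x∈S =
    suc-injective (trans (∣p-x∣+1≡∣p∣ x∈S) ∣S∣≡1+r) ,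
    λ y z y∈ z∈ → S-adj y z (p─q⊆p S _ y∈) (p─q⊆p S _ z∈)

  remove⊆nbhd : ∀ {r V S x} → IsClique r S → S ⊆ V → x ∈ S → S - x ⊆ nbhd V x
  remove⊆nbhd {S = S} (_ , S-adj) S⊆V x∈S {y} y∈ =
    ∈-nbhd⁺ (S⊆V y∈S) (x≢y ∘ sym) (S-adj _ y x∈S y∈S (x≢y ∘ sym))
    where
    y∈S = p─q⊆p S _ y∈
    x≢y = x∈p-y⇒x≢y y∈

  nbhd-CliqueFree : ∀ {r V x} → CliqueFree (suc r) V → x ∈ V → CliqueFree r (nbhd V x)
  nbhd-CliqueFree free x∈V S⊆nbhd S-clique = free (⁅x⁆∪nbhd⊆ x∈V S⊆nbhd) (clique-insert S-clique S⊆nbhd)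

  meets-non-nbhd : ∀ {r V S x} → CliqueFree (suc (suc r)) V → x ∈ V → S ⊆ V → IsClique (suc r) S →
    ∃ λ w → w ∈ S × w ∈ V ─ nbhd V x
  meets-non-nbhd {V = V} {S} {x} free x∈V S⊆V S-clique
    with Fin.any? (λ y → y ∈? S ×-dec y ∈? V ─ nbhd V x)
  ... | yes found = found
  ... | no none = ⊥-elim (free (⁅x⁆∪nbhd⊆ x∈V S⊆nbhd) (clique-insert S-clique S⊆nbhd))
    where
    S⊆nbhd : S ⊆ nbhd V x
    S⊆nbhd {y} y∈S with y ∈? nbhd V x
    ... | yes y∈ = y∈
    ... | no y∉  = ⊥-elim (none (y , y∈S , x∈p∧x∉q⇒x∈p─q (S⊆V y∈S) y∉))

  -- Zykov symmetrisation: for x of maximum degree, every (r+1)-clique meets W = V ─ nbhd V x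
  -- (else it extends by x), and the cliques through w ∈ W, minus w, are r-cliques of nbhd V w.
  cliques-≤-turán : ∀ r {V} → CliqueFree (suc r) V → ∀ {m} (f : Fin m → Subset n) → Injective _≡_ _≡_ f →
    (∀ t → f t ⊆ V) → (∀ t → IsClique r (f t)) → m ≤ turán ∣ V ∣ r
  cliques-≤-turán zero    _ {zero}        _ _     _ _        = z≤n
  cliques-≤-turán zero    _ {suc zero}    _ _     _ _        = ≤-refl
  cliques-≤-turán zero    _ {suc (suc m)} f f-inj _ f-clique =
    ⊥-elim (Fin.0≢1+n (f-inj (trans (empty zero) (sym (empty (suc zero))))))
    where
    empty : ∀ t → f t ≡ ⊥
    empty t = Empty-unique (∣p∣≡0⇒Empty (proj₁ (f-clique t)))
  cliques-≤-turán (suc r) _    {zero}  _ _     _   _        = z≤n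
  cliques-≤-turán (suc r) {V} free {suc m} f f-inj f⊆V f-clique = begin
    suc m                          ≤⟨ bounded-fibres ℓ ℓ∈W fibre-≤ ⟩
    ∣ W ∣ * turán (deg x) r        ≤⟨ *-turán-≤ r ∣ W ∣ (deg x) ⟩
    turán (∣ W ∣ + deg x) (suc r)  ≤⟨ turán-monoˡ-≤ (suc r) (∣p∣+∣q∣≤∣r∣ (p─q⊆p V _) nbhd⊆ (x∈p─q⇒x∉q V _)) ⟩
    turán ∣ V ∣ (suc r)            ∎
    where
    open ≤-Reasoning
    deg : Fin n → ℕ
    deg y = ∣ nbhd V y ∣
    V-nonempty : Nonempty V
    V-nonempty with ∣p∣≡1+k⇒Nonempty (proj₁ (f-clique zero))
    ... | y , y∈f₀ = y , f⊆V zero y∈f₀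
    max-deg = argmax-∈ deg V V-nonempty
    x = proj₁ max-deg
    x∈V = proj₁ (proj₂ max-deg)
    W = V ─ nbhd V x
    meets : ∀ t → ∃ λ w → w ∈ f t × w ∈ W
    meets t = meets-non-nbhd free x∈V (f⊆V t) (f-clique t)
    ℓ : Fin (suc m) → Fin n
    ℓ = proj₁ ∘ meets
    ℓ∈W : ∀ t → ℓ t ∈ W
    ℓ∈W = proj₂ ∘ proj₂ ∘ meets
    fibre-≤ : ∀ {w} → w ∈ W → ∀ {m′} (g : Fin m′ → Fin (suc m)) → Injective _≡_ _≡_ g →
      (∀ j → ℓ (g j) ≡ w) → m′ ≤ turán (deg x) r
    fibre-≤ {w} w∈W g g-inj ℓg≡w = ≤-trans
      (cliques-≤-turán r (nbhd-CliqueFree free w∈V) (λ j → f (g j) - w)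
        (λ eq → g-inj (f-inj (p-x≡q-x⇒p≡q (w∈f _) (w∈f _) eq)))
        (λ j → remove⊆nbhd (f-clique (g j)) (f⊆V (g j)) (w∈f j))
        (λ j → clique-remove (f-clique (g j)) (w∈f j)))
      (turán-monoˡ-≤ r (proj₂ (proj₂ max-deg) w∈V))
      where
      w∈V = p─q⊆p V _ w∈W
      w∈f : ∀ j → w ∈ f (g j)
      w∈f j = subst (_∈ f (g j)) (ℓg≡w j) (proj₁ (proj₂ (meets (g j))))

  image-clique : ∀ {m r} {e : Fin m → Fin n} {S : Subset m} → Injective _≡_ _≡_ e → ∣ S ∣ ≡ r →
    (∀ x y → x ∈ S → y ∈ S → x ≢ y → E (e x) (e y)) → IsClique r (image e S)
  image-clique {e = e} {S} e-inj ∣S∣≡r S-adj = trans (∣image∣≡∣p∣ e e-inj) ∣S∣≡r , adj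
    where
    adj : ∀ y z → y ∈ image e S → z ∈ image e S → y ≢ z → E y z
    adj y z y∈ z∈ y≢z with ∈-image⁻ e y∈ | ∈-image⁻ e z∈
    ... | x , x∈S , refl | x′ , x′∈S , refl = S-adj x x′ x∈S x′∈S (y≢z ∘ cong e)

-- Without function extensionality, searching Fin n → A needs predicates respecting pointwise equality.
Searchable : (A : Set) → Rel A 0ℓ → Set₁
Searchable A _≈_ = ∀ {P : Pred A 0ℓ} → (∀ {a b} → a ≈ b → P a → P b) → Decidable P → Dec (∃ P)

Fin-searchable : ∀ {k} → Searchable (Fin k) _≡_
Fin-searchable _ P? = Fin.any? P?

→-searchable : ∀ n {A : Set} {_≈_ : Rel A 0ℓ} → Reflexive _≈_ → Searchable A _≈_ →
  Searchable (Fin n → A) (λ f g → ∀ i → f i ≈ g i)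
→-searchable zero ≈-refl search {P} resp P? with P? (λ ())
... | yes P[] = yes (_ , P[])
... | no ¬P[] = no λ (f , Pf) → ¬P[] (resp (λ ()) Pf)
→-searchable (suc n) {A} {_≈_} ≈-refl search {P} resp P?
  with search {λ a → ∃ λ g → P (a Vector.∷ g)} resp-head
         (λ a → →-searchable n ≈-refl search (resp-tail a) (λ g → P? (a Vector.∷ g)))
  where
  resp-head : ∀ {a b} → a ≈ b → ∃ (λ g → P (a Vector.∷ g)) → ∃ (λ g → P (b Vector.∷ g))
  resp-head a≈b (g , Pag) = g , resp (λ { zero → a≈b ; (suc i) → ≈-refl }) Pag
  resp-tail : ∀ a {g h} → (∀ i → g i ≈ h i) → P (a Vector.∷ g) → P (a Vector.∷ h)
  resp-tail a g≈h = resp (λ { zero → ≈-refl ; (suc i) → g≈h i })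
... | yes (a , g , Pag) = yes (a Vector.∷ g , Pag)
... | no none =
  no λ (f , Pf) → none (Vector.head f , Vector.tail f , resp (λ { zero → ≈-refl ; (suc i) → ≈-refl }) Pf)

_≗ᶜ_ : ∀ {n k} → Rel (Colouring n k) 0ℓ
c ≗ᶜ c′ = ∀ x y → col c x y ≡ col c′ x y

Colouring-searchable : ∀ {n k} → Searchable (Colouring n k) _≗ᶜ_
Colouring-searchable {n} {k} {P} resp P?
  with →-searchable n (λ _ → refl) (→-searchable n refl Fin-searchable) resp-sym sym-P?
  where
  SymP : (Fin n → Fin n → Fin k) → Set
  SymP f = Σ (∀ x y → f x y ≡ f y x) λ f-sym → P (record { col = f ; sym = f-sym })
  resp-sym : ∀ {f g} → (∀ x y → f x y ≡ g x y) → SymP f → SymP g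
  resp-sym f≗g (f-sym , Pf) =
    (λ x y → trans (sym (f≗g x y)) (trans (f-sym x y) (f≗g y x))) , resp f≗g Pf
  sym-P? : Decidable SymP
  sym-P? f with Fin.all? (λ x → Fin.all? (λ y → f x y Fin.≟ f y x))
  ... | no asym = no (asym ∘ proj₁)
  ... | yes f-sym with P? (record { col = f ; sym = f-sym })
  ...   | yes Pf = yes (f-sym , Pf)
  ...   | no ¬Pf = no λ (_ , Pf′) → ¬Pf (resp (λ _ _ → refl) Pf′)
... | yes (f , f-sym , Pf) = yes (_ , Pf)
... | no none = no λ (c , Pc) → none (col c , Colouring.sym c , Pc)

Mono? : ∀ {n k} (s : Fin k → ℕ) (c : Colouring n k) i S → Dec (Mono s c i S)
Mono? s c i S = (∣ S ∣ ≟ s i) ×-dec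
  Fin.all? λ x → Fin.all? λ y → x ∈? S →-dec y ∈? S →-dec ¬? (x Fin.≟ y) →-dec col c x y Fin.≟ i

HasMono? : ∀ {n k} (s : Fin k → ℕ) (c : Colouring n k) → Dec (HasMono s c)
HasMono? s c = map′ (λ (i , S , mono) → (i , S) , mono) (λ ((i , S) , mono) → i , S , mono)
  (Fin.any? λ i → anySubset? (Mono? s c i))

HasMono-resp : ∀ {n k} (s : Fin k → ℕ) {c c′ : Colouring n k} → c ≗ᶜ c′ → HasMono s c → HasMono s c′
HasMono-resp s c≗c′ ((i , S) , size , mono) =
  (i , S) , size , λ x y x∈ y∈ x≢y → trans (sym (c≗c′ x y)) (mono x y x∈ y∈ x≢y)

critical-colouring : ∀ {k n} (s : Fin k → ℕ) → ¬ (∀ (c : Colouring n k) → HasMono s c) → ∃ λ c → ¬ HasMono s c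
critical-colouring {k = k} {n = n} s not-all =
  decide (Colouring-searchable (λ {c} {c′} → ¬mono-resp {c} {c′}) (λ c → ¬? (HasMono? s c)))
  where
  ¬mono-resp : ∀ {c c′ : Colouring n k} → c ≗ᶜ c′ → ¬ HasMono s c → ¬ HasMono s c′
  ¬mono-resp {c} {c′} c≗c′ ¬mono = ¬mono ∘ HasMono-resp s {c′} {c} (λ x y → sym (c≗c′ x y))
  decide : Dec (∃ λ c → ¬ HasMono s c) → ∃ λ c → ¬ HasMono s c
  decide (yes found) = found
  decide (no none)   = ⊥-elim (not-all λ c → decidable-stable (HasMono? s c) (λ ¬mono → none (c , ¬mono)))

HasColour : ∀ {n k} → Colouring n k → Fin k → Fin n → Fin n → Set
HasColour c i x y = col c x y ≡ i

hasColour? : ∀ {n k} (c : Colouring n k) i x y → Dec (HasColour c i x y)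
hasColour? c i x y = col c x y Fin.≟ i

hasColour-sym : ∀ {n k} (c : Colouring n k) i {x y} → HasColour c i x y → HasColour c i y x
hasColour-sym c i {x} {y} = trans (Colouring.sym c y x)

-- Its cliques of size s i are literally the copies Mono s c i.
module ColourClass {n k} (c : Colouring n k) (i : Fin k) =
  Graph (HasColour c i) (hasColour? c i) (hasColour-sym c i)

pullback : ∀ {m n k k′} → (Fin k → Fin k′) → (Fin m → Fin n) → Colouring n k → Colouring m k′
pullback φ e c = record
  { col = λ x y → φ (col c (e x) (e y))
  ; sym = λ x y → cong φ (Colouring.sym c (e x) (e y))
  }

sumFin-2+ : ∀ {k} (f : Fin k → ℕ) → sumFin (λ i → 2 + f i) ≡ 2 * k + sumFin f
sumFin-2+ {zero}  f = refl
sumFin-2+ {suc k} f = begin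
  2 + f zero + sumFin (λ i → 2 + f (suc i))   ≡⟨ cong (2 + f zero +_) (sumFin-2+ (f ∘ suc)) ⟩
  2 + f zero + (2 * k + sumFin (f ∘ suc))     ≡⟨ regroup (f zero) k (sumFin (f ∘ suc)) ⟩
  2 * suc k + (f zero + sumFin (f ∘ suc))     ∎
  where
  open ≡-Reasoning
  regroup : ∀ a k b → 2 + a + (2 * k + b) ≡ 2 * suc k + (a + b)
  regroup = solve-∀

module CriticalColouring {N K′ : ℕ} (s : Fin (suc (suc K′)) → ℕ) (s≥2 : ∀ i → 2 ≤ s i)
             (c : Colouring (suc N) (suc (suc K′))) (no-mono : ¬ HasMono s c) where

  private
    K : ℕ
    K = suc (suc K′)
    module C = ColourClass c

  s≡2+ : ∀ i → s i ≡ suc (suc (s i ∸ 2))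
  s≡2+ i = sym (m+[n∸m]≡n (s≥2 i))

  c-free : ∀ i → C.CliqueFree i (s i) ⊤
  c-free i {S} _ S-clique = no-mono ((i , S) , S-clique)

  V : Fin K → Subset (suc N)
  V i = C.nbhd i ⊤ zero

  d : Fin K → ℕ
  d i = ∣ V i ∣

  V-free : ∀ i → C.CliqueFree i (suc (s i ∸ 2)) (V i)
  V-free i = C.nbhd-CliqueFree i (subst (λ r → C.CliqueFree i r ⊤) (s≡2+ i) (c-free i)) ∈⊤

  -- Vertex zero of clone i is a twin of vertex zero of c, joined to it in colour i.
  twin-row : Fin K → Fin (suc N) → Fin K
  twin-row i zero    = i
  twin-row i (suc y) = col c zero (suc y)

  clone-col : Fin K → Fin (suc (suc N)) → Fin (suc (suc N)) → Fin K
  clone-col i zero    zero    = i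
  clone-col i zero    (suc y) = twin-row i y
  clone-col i (suc x) zero    = twin-row i x
  clone-col i (suc x) (suc y) = col c x y

  clone-col-sym : ∀ i x y → clone-col i x y ≡ clone-col i y x
  clone-col-sym i zero    zero    = refl
  clone-col-sym i zero    (suc y) = refl
  clone-col-sym i (suc x) zero    = refl
  clone-col-sym i (suc x) (suc y) = Colouring.sym c x y

  clone : Fin K → Colouring (suc (suc N)) K
  clone i = record { col = clone-col i ; sym = clone-col-sym i }

  old-vertices-adjacent : ∀ {i j b S} → Mono s (clone i) j (b ∷ S) →
    ∀ x y → x ∈ S → y ∈ S → x ≢ y → col c x y ≡ j
  old-vertices-adjacent (_ , adj) x y x∈S y∈S x≢y =
    adj (suc x) (suc y) (there x∈S) (there y∈S) (x≢y ∘ Fin.suc-injective)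

  -- A copy missing the twin, or containing it but not vertex zero, would be a copy in c.
  copy-through-twins : ∀ {i j S} → Mono s (clone i) j S → j ≡ i × head S ≡ inside × zero ∈ tail S
  copy-through-twins {S = outside ∷ S} mono@(size , _) =
    ⊥-elim (no-mono ((_ , S) , size , old-vertices-adjacent mono))
  copy-through-twins {j = j} {S = inside ∷ S} mono@(size , adj) with zero ∈? S
  ... | yes 0∈S = sym (adj zero (suc zero) here (there 0∈S) (λ ())) , refl , 0∈S
  ... | no 0∉S  = ⊥-elim (c-free j (λ _ → ∈⊤) (trans (proj₁ clique) size , proj₂ clique))
    where
    S⊆nbhd : S ⊆ C.nbhd j ⊤ zero
    S⊆nbhd {zero}  0∈S = ⊥-elim (0∉S 0∈S)
    S⊆nbhd {suc y} y∈S = C.∈-nbhd⁺ j ∈⊤ (λ ()) (adj zero (suc (suc y)) here (there y∈S) (λ ()))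
    clique = C.clique-insert j (refl , old-vertices-adjacent mono) S⊆nbhd

  copy-clique : ∀ {i j S} → Mono s (clone i) j S →
    C.IsClique i (s i ∸ 2) (tail S - zero) × tail S - zero ⊆ V i
  copy-clique mono with copy-through-twins mono
  copy-clique {S = outside ∷ S} mono | _ , () , _
  copy-clique {i} {S = inside ∷ S} mono@(size , _) | refl , _ , 0∈S =
    C.clique-remove i tail-clique 0∈S , C.remove⊆nbhd i tail-clique (λ _ → ∈⊤) 0∈S
    where
    tail-clique : C.IsClique i (suc (s i ∸ 2)) S
    tail-clique = suc-injective (trans size (s≡2+ i)) , old-vertices-adjacent mono

  copy-determined : ∀ {i j j′ S S′} → Mono s (clone i) j S → Mono s (clone i) j′ S′ →
    tail S - zero ≡ tail S′ - zero → (j , S) ≡ (j′ , S′)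
  copy-determined {S = _ ∷ S} {S′ = _ ∷ S′} mono mono′ eq
    with copy-through-twins mono | copy-through-twins mono′
  ... | refl , refl , 0∈S | refl , refl , 0∈S′ = cong (λ T → _ , inside ∷ T) (p-x≡q-x⇒p≡q 0∈S 0∈S′ eq)

  copies-≤-turán : ∀ i {m} → AtLeast s m (clone i) → m ≤ turán (d i) (s i ∸ 2)
  copies-≤-turán i (copies , copies-inj) =
    C.cliques-≤-turán i (s i ∸ 2) (V-free i) (λ t → tail (proj₂ (proj₁ (copies t))) - zero)
      (λ eq → copies-inj (copy-determined (proj₂ (copies _)) (proj₂ (copies _)) eq))
      (proj₂ ∘ copy-clique ∘ proj₂ ∘ copies) (proj₁ ∘ copy-clique ∘ proj₂ ∘ copies)

  s∸2≤d : ∀ i → HasMono s (clone i) → s i ∸ 2 ≤ d i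
  s∸2≤d i ((_ , S) , mono) with copy-clique mono
  ... | (size , _) , ⊆V = subst (_≤ d i) size (p⊆q⇒∣p∣≤∣q∣ ⊆V)

  Σd≤N : sumFin d ≤ N
  Σd≤N = subst (sumFin d ≤_) ∣⊤-0∣≡N (sumFin-∣∣≤ V V⊆⊤-0 disjoint)
    where
    ∣⊤-0∣≡N : ∣ ⊤ {suc N} - zero ∣ ≡ N
    ∣⊤-0∣≡N = suc-injective (trans (∣p-x∣+1≡∣p∣ (∈⊤ {x = zero {N}})) (∣⊤∣≡n (suc N)))
    V⊆⊤-0 : ∀ i → V i ⊆ ⊤ - zero
    V⊆⊤-0 i y∈V = x∈p∧x≢y⇒x∈p-y ∈⊤ (proj₁ (proj₂ (C.∈-nbhd⁻ i y∈V)) ∘ sym)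
    disjoint : ∀ {i j x} → x ∈ V i → x ∈ V j → i ≡ j
    disjoint {i} {j} x∈Vi x∈Vj =
      trans (sym (proj₂ (proj₂ (C.∈-nbhd⁻ i x∈Vi)))) (proj₂ (proj₂ (C.∈-nbhd⁻ j x∈Vj)))

  Σ[2+d]≤ : sumFin (λ i → 2 + d i) ≤ suc (suc N) + 2 * suc K′
  Σ[2+d]≤ = begin
    sumFin (λ i → 2 + d i)       ≡⟨ sumFin-2+ d ⟩
    2 * K + sumFin d             ≤⟨ +-monoʳ-≤ (2 * K) Σd≤N ⟩
    2 * K + N                    ≡⟨ regroup K′ N ⟩
    suc (suc N) + 2 * suc K′     ∎
    where
    open ≤-Reasoning
    regroup : ∀ K′ N → 2 * suc (suc K′) + N ≡ suc (suc N) + 2 * suc K′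
    regroup = solve-∀

  split : Fin K → Fin K → Fin 2
  split a b with b Fin.≟ a
  ... | yes _ = zero
  ... | no _  = suc zero

  split≡0 : ∀ a b → split a b ≡ zero → b ≡ a
  split≡0 a b _ with b Fin.≟ a
  split≡0 a b _  | yes b≡a = b≡a
  split≡0 a b () | no _

  split≡1 : ∀ a b → split a b ≡ suc zero → b ≢ a
  split≡1 a b _ with b Fin.≟ a
  split≡1 a b () | yes _
  split≡1 a b _  | no b≢a = b≢a

  -- The value at b = a is junk: off the diagonal squeeze a is only applied to colours other than a.
  squeeze : Fin K → Fin K → Fin (suc K′)
  squeeze a b with b Fin.≟ a
  ... | yes _  = zero
  ... | no b≢a = punchOut (b≢a ∘ sym)

  punchIn-squeeze : ∀ a b → b ≢ a → punchIn a (squeeze a b) ≡ b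
  punchIn-squeeze a b b≢a with b Fin.≟ a
  ... | yes b≡a  = ⊥-elim (b≢a b≡a)
  ... | no b≢a′  = Fin.punchIn-punchOut (b≢a′ ∘ sym)

  colour-avoiding-not-ramsey : ∀ a {m} (e : Fin m → Fin (suc N)) → Injective _≡_ _≡_ e →
    (∀ x y → x ≢ y → col c (e x) (e y) ≢ a) → ¬ (∀ (c′ : Colouring m (suc K′)) → HasMono (remove s a) c′)
  colour-avoiding-not-ramsey a e e-inj avoids ramsey with ramsey (pullback (squeeze a) e c)
  ... | (j , S) , size , adj = c-free (punchIn a j) (λ _ → ∈⊤) (C.image-clique (punchIn a j) e-inj size adj′)
    where
    adj′ : ∀ x y → x ∈ S → y ∈ S → x ≢ y → col c (e x) (e y) ≡ punchIn a j
    adj′ x y x∈S y∈S x≢y =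
      trans (sym (punchIn-squeeze a _ (avoids x y x≢y))) (cong (punchIn a) (adj x y x∈S y∈S x≢y))

  d<Rn : ∀ a {Rm Rn} → IsRamsey (suc K′) (remove s a) Rm → IsRamsey 2 (pair (s a ∸ 1) Rm) Rn → d a < Rn
  d<Rn a {Rm} {Rn} isRm isRn with Rn ≤? d a
  ... | no Rn≰d  = ≰⇒> Rn≰d
  ... | yes Rn≤d = ⊥-elim (no-copy (proj₁ isRn (pullback (split a) e c)))
    where
    e : Fin Rn → Fin (suc N)
    e x = enum (V a) (inject≤ x Rn≤d)
    e-inj : Injective _≡_ _≡_ e
    e-inj eq = Fin.inject≤-injective Rn≤d Rn≤d _ _ (enum-injective (V a) eq)
    no-copy : ¬ HasMono (pair (s a ∸ 1) Rm) (pullback (split a) e c)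
    no-copy ((zero , S) , size , adj) =
      V-free a image⊆V (C.image-clique a e-inj (trans size (cong (_∸ 1) (s≡2+ a)))
                          (λ x y x∈S y∈S x≢y → split≡0 a _ (adj x y x∈S y∈S x≢y)))
      where
      image⊆V : image e S ⊆ V a
      image⊆V y∈ with ∈-image⁻ e y∈
      ... | x , _ , refl = enum-∈ (V a) _
    no-copy ((suc zero , S) , size , adj) =
      colour-avoiding-not-ramsey a (e ∘ enum S) (enum-injective S ∘ e-inj) avoids
        (subst (λ m → ∀ (c′ : Colouring m (suc K′)) → HasMono (remove s a) c′) (sym size) (proj₁ isRm))
      where
      avoids : ∀ x y → x ≢ y → col c (e (enum S x)) (e (enum S y)) ≢ a
      avoids x y x≢y = split≡1 a _ (adj _ _ (enum-∈ S x) (enum-∈ S y) (x≢y ∘ enum-injective S))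

3≤Ramsey : ∀ {k R} {s : Fin (suc k) → ℕ} → (∀ i → 3 ≤ s i) → IsRamsey (suc k) s R → 3 ≤ R
3≤Ramsey s≥3 (all-mono , _) with all-mono (record { col = λ _ _ → zero ; sym = λ _ _ → refl })
... | (i , S) , size , _ = ≤-trans (s≥3 i) (subst (_≤ _) size (∣p∣≤n S))

∸-<-∸ : ∀ {x y z w} → x < z → w ≤ y → y ≤ x → x ∸ y < z ∸ w
∸-<-∸ {x} x<z w≤y y≤x = ≤-<-trans (∸-monoʳ-≤ x w≤y) (∸-monoˡ-< x<z (≤-trans w≤y y≤x))

theorem3p7 : (k : ℕ) → 2 ≤ k → (s : Fin k → ℕ) → (∀ i → 3 ≤ s i) →
    (R : ℕ) → IsRamsey k s R →
    (Rm : Fin k → ℕ) → (∀ a → IsRamsey (Data.Nat.pred k) (remove s a) (Rm a)) →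
    (Rn : Fin k → ℕ) → (∀ a → IsRamsey 2 (pair (s a ∸ 1) (Rm a)) (Rn a)) →
    (m : ℕ) → IsCritMult k s R m →
    Σ (Fin k → ℕ) (λ n →
      (∀ i → s i ≤ n i) ×
      (sumFin n ≤ R + 2 * (k ∸ 1)) ×
      (∀ a b → a ≢ b → n b ≤ n a → n a ∸ n b < Rn a ∸ (s b ∸ 2)) ×
      (∀ i → m ≤ P (s i) (n i)))
theorem3p7 (suc (suc k′)) (s≤s (s≤s z≤n)) s s≥3 R isR Rm isRm Rn isRn m isCM with 3≤Ramsey s≥3 isR
... | s≤s (s≤s {n = N} _) with critical-colouring s (λ all-mono → <-irrefl refl (proj₂ isR (suc N) all-mono))
...   | c , no-mono = (λ i → 2 + d i) , s≤2+d , Σ[2+d]≤ , gap , λ i → copies-≤-turán i (proj₁ isCM (clone i))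
  where
  open CriticalColouring s (λ i → <⇒≤ (s≥3 i)) c no-mono
  s∸2≤d′ : ∀ i → s i ∸ 2 ≤ d i
  s∸2≤d′ i = s∸2≤d i (proj₁ isR (clone i))
  s≤2+d : ∀ i → s i ≤ 2 + d i
  s≤2+d i = ≤-trans (m≤n+m∸n (s i) 2) (+-monoʳ-≤ 2 (s∸2≤d′ i))
  gap : ∀ a b → a ≢ b → 2 + d b ≤ 2 + d a → d a ∸ d b < Rn a ∸ (s b ∸ 2)
  gap a b _ db≤da = ∸-<-∸ (d<Rn a (isRm a) (isRn a)) (s∸2≤d′ b) (+-cancelˡ-≤ 2 _ _ db≤da)
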